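{- Let $\mathcal{C}$ be any $f$-separable hereditary class, where $f:\mathbb{N}_+\to\mathbb{N}_+$, and let $$C_f(n)=f(n)+\sum_{i=0}^{\ell(n)} f\Big(\Big\lfloor\Big(\tfrac23\Big)^i n\Big\rfloor\Big),\qquad \ell(n)=\lceil\log_{3/2}n\rceil+1.$$ Then for any $n$-vertex $G\in\mathcal{C}$, the STT algorithm uses $C_f(n)$ cops, and thus $\mathsf{cop}_0(G)\le C_f(n)$.
   Context: Zero-visibility Cops and Robbers on $G$: $k$ cops choose starting vertices, then the robber; in each round each cop stays or moves to a neighbour, then the robber does likewise; the robber sees the cops but the cops never know the robber's position; the cops win if a cop occupies the robber's vertex. $\mathsf{cop}_0(G)$ is the minimum $k$ for which the cops can guarantee capture. A set $S\subset V$ is an $(s,\alpha)$-separator of $G=(V,E)$ if $V=A\cup B\cup S$ with $A,B,S$ pairwise disjoint, $|S|\le s$, $|A|,|B|\le\alpha|V|$ and no edge joins $A$ and $B$. The separation number $\mathrm{s}(G)$ is the least $s$ such that every subgraph of $G$ has an $(s,2/3)$-separator. $\mathcal{C}$ is $f$-separable if every $n$-vertex $G\in\mathcal{C}$ has $\mathrm{s}(G)\le f(n)$; hereditary means closed under induced subgraphs. STT uses a separation algorithm $\mathcal{S}$ returning, for a graph $H$ in $\mathcal{C}$ with $m$ vertices, a partition $(A,B,C)$ of $V(H)$ with $C$ an $(f(m),2/3)$-separator and separated sets $A,B$. STT on an $n$-vertex $G$: it keeps Stack-B of pairs (vertex set, binary string index) and Stack-C of pairs (separator, index). Scheduler: push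 $(V(G),\varepsilon)$ on Stack-B, Stack-C empty. While Stack-B is nonempty: pop $(U,w)$; let $p$ be $w$ without its last character; if Stack-C is nonempty then, while $p$ differs from the index of the top of Stack-C, pop $(S,w')$ from Stack-C and remove the cops from $S$; then call Separate$(G[U],w,n)$. Separate$(H,w,n)$: if $|V(H)|\le f(n)$, place cops on all vertices of $H$ and then remove them; otherwise compute $(A,B,C)=\mathcal{S}(H)$, place cops on all vertices of $C$, push $(C,w)$ onto Stack-C, then push $(B,w\cdot0)$ and $(A,w\cdot1)$ onto Stack-B. When cops must move along edges, each placement is realised by walking cops to the target vertices. The number of cops used is the number of cops needed to carry out all placements. -}

module Defs where

open import Data.Nat using (ℕ; zero; suc; _+_; _*_; _^_; _≤_; _/_; _≤ᵇ_)
open import Data.Nat.Properties using (m^n≢0)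
open import Data.Fin using (Fin)
open import Data.Bool using (Bool; true; false; if_then_else_)
open import Data.Product using (Σ; ∃; _×_; _,_)
open import Data.Sum using (_⊎_)
open import Data.Empty using (⊥)
open import Relation.Nullary using (¬_)
open import Relation.Binary.PropositionalEquality using (_≡_; refl)
open import Function.Definitions using (Injective)

record Graph (n : ℕ) : Set₁ where
  field
    Adj   : Fin n → Fin n → Set
    sym   : ∀ {u v} → Adj u v → Adj v u
    irrfl : ∀ {u} → ¬ Adj u u
open Graph public

Class : Set₁
Class = ∀ {n} → Graph n → Set

induced : ∀ {m n} → Graph n → (Fin m → Fin n) → Graph m
induced G ι = record
  { Adj = λ i j → Adj G (ι i) (ι j)
  ; sym = sym G
  ; irrfl = irrfl G }

Hereditary : Class → Set₁
Hereditary C = ∀ {m n} (G : Graph n) (ι : Fin m → Fin n) →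
  Injective _≡_ _≡_ ι → C G → C (induced G ι)

IsSubgraph : ∀ {m n} → Graph m → Graph n → Set
IsSubgraph {m} {n} H G = Σ (Fin m → Fin n) λ ι →
  Injective _≡_ _≡_ ι × (∀ i j → Adj H i j → Adj G (ι i) (ι j))

data Part : Set where
  inA inB inS : Part

isA isB isS : Part → Bool
isA inA = true
isA _   = false
isB inB = true
isB _   = false
isS inS = true
isS _   = false

count : ∀ {m} → (Fin m → Bool) → ℕ
count {zero}  p = 0
count {suc m} p = (if p Fin.zero then 1 else 0) + count (λ i → p (Fin.suc i))
  where import Data.Fin as Fin

HasSeparator : ∀ {m} → Graph m → ℕ → Set
HasSeparator {m} H s = Σ (Fin m → Part) λ lab →
    count (λ i → isS (lab i)) ≤ s
  × 3 * count (λ i → isA (lab i)) ≤ 2 * m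
  × 3 * count (λ i → isB (lab i)) ≤ 2 * m
  × (∀ i j → lab i ≡ inA → lab j ≡ inB → ¬ Adj H i j)

-- s(G) ≤ s : the least s' such that every subgraph of G has an
-- (s',2/3)-separator is at most s.
SepNum≤ : ∀ {n} → Graph n → ℕ → Set₁
SepNum≤ G s = ∃ λ s' → s' ≤ s ×
  (∀ m (H : Graph m) → IsSubgraph H G → HasSeparator H s')

Separable : Class → (ℕ → ℕ) → Set₁
Separable C f = ∀ n (G : Graph n) → C G → SepNum≤ G (f n)

Step : ∀ {n} → Graph n → Fin n → Fin n → Set
Step G u v = u ≡ v ⊎ Adj G u v

data Reach {n} (G : Graph n) : Fin n → Fin n → Set where
  here  : ∀ {u} → Reach G u u
  there : ∀ {u v w} → Adj G u v → Reach G v w → Reach G u w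

Connected : ∀ {n} → Graph n → Set
Connected G = ∀ u v → Reach G u v

CopWalk : ∀ {n} → Graph n → ℕ → Set
CopWalk {n} G k = Σ (ℕ → Fin k → Fin n) λ c →
  ∀ t j → Step G (c t j) (c (suc t) j)

RobberWalk : ∀ {n} → Graph n → Set
RobberWalk {n} G = Σ (ℕ → Fin n) λ r → ∀ t → Step G (r t) (r (suc t))

-- time 0: cops at c 0, robber at r 0; round t+1: cops move to c (t+1)
-- (robber still at r t), then robber moves to r (t+1).
Caught : ∀ {n k} (G : Graph n) → CopWalk G k → RobberWalk G → Set
Caught G (c , _) (r , _) = ∃ λ t → ∃ λ j → c t j ≡ r t ⊎ c (suc t) j ≡ r t

-- k cops can guarantee capture (cops have no information, so a strategy
-- is a fixed cop walk; it must catch every robber walk)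
CopsWin : ∀ {n} → Graph n → ℕ → Set
CopsWin G k = Σ (CopWalk G k) λ cw → (rw : RobberWalk G) → Caught G cw rw

Cop0≤ : ∀ {n} → Graph n → ℕ → Set
Cop0≤ G k = ∃ λ k' → k' ≤ k × CopsWin G k'

search : ℕ → ℕ → ℕ → ℕ
search n k zero = k
search n k (suc fuel) = if n * 2 ^ k ≤ᵇ 3 ^ k then k else search n (suc k) fuel

-- ⌈log_{3/2} n⌉ for n ≥ 1 (the answer is always ≤ n)
clog32 : ℕ → ℕ
clog32 n = search n 0 n

ℓ : ℕ → ℕ
ℓ n = clog32 n + 1

shrink : ℕ → ℕ → ℕ
shrink i n = _/_ (2 ^ i * n) (3 ^ i) {{m^n≢0 3 i}}

sumTo : (ℕ → ℕ) → ℕ → ℕ → ℕ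
sumTo f n zero = f (shrink 0 n)
sumTo f n (suc L) = sumTo f n L + f (shrink (suc L) n)

Cf : (ℕ → ℕ) → ℕ → ℕ
Cf f n = f n + sumTo f n (ℓ n)

-- The cops replay the recursion of STT. Their slots come in levels: level 0 holds the f(n) cops
-- that occupy a whole leaf, and level d + 1 the f(⌊(2/3)^d n⌋) cops that stay on the separator
-- chosen at depth d. A depth-d subproblem has at most ⌊(2/3)^d n⌋ vertices, so separators are
-- only chosen at depths d ≤ ℓ(n), and C_f(n) slots suffice. Throughout, every vertex from which
-- the robber could step into the cleared region or into the current subproblem belongs to it or
-- carries a cop of an ancestor separator. Hence, once the separator S of U = A ∪ B ∪ S is
-- occupied, clearing B and then A clears U; and a cleared region stays cleared while cops walk
-- along paths of the connected graph to their next positions.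
module Submission where

open import Defs hiding (sym)
open import Data.Bool using (Bool; true; false; T; if_then_else_)
open import Data.Empty using (⊥-elim)
open import Data.Fin as Fin using (Fin; toℕ; fromℕ<; inject≤; _↑ˡ_; _↑ʳ_; splitAt)
import Data.Fin.Properties as Finₚ
open import Data.List using (List; []; _∷_; length; map; filter; tabulate; _++_; lookup; allFin)
open import Data.List.Properties using (length-map; length-tabulate; length-++-≤ˡ)
open import Data.List.Membership.Propositional using (_∈_)
open import Data.List.Membership.Propositional.Properties
  using (∈-map⁺; ∈-map⁻; ∈-filter⁺; ∈-filter⁻; ∈-allFin; ∈-lookup; ∈-++⁺ˡ; ∈-++⁺ʳ)
import Data.List.Relation.Unary.All as All
open import Data.List.Relation.Unary.AllPairs using (_∷_)
open import Data.List.Relation.Unary.Any using (here; there; index)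
open import Data.List.Relation.Unary.Any.Properties using (lookup-index)
open import Data.List.Relation.Unary.Unique.Propositional using (Unique)
import Data.List.Relation.Unary.Unique.Propositional.Properties as Uniqueₚ
open import Data.Nat using (ℕ; zero; suc; _+_; _*_; _^_; _≤_; _<_; _/_; _≟_; _≤?_; _≤ᵇ_; z≤n; s≤s; s≤s⁻¹; NonZero)
open import Data.Nat.Properties
open import Data.Nat.DivMod using (m/n*n≤m; m*n/n≡m; /-monoˡ-≤; n/1≡n)
open import Data.Nat.Solver using (module +-*-Solver)
open +-*-Solver using (solve; _:+_; _:*_; _:=_; con)
open import Data.Product using (Σ; ∃; _×_; _,_; proj₁; proj₂)
open import Data.Product.Properties using (≡-dec)
open import Data.Sum using (_⊎_; inj₁; inj₂; [_,_]′)
import Data.Sum as Sum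
open import Data.Unit using (⊤; tt)
open import Function using (_∘_)
open import Function.Definitions using (Injective)
open import Level using (0ℓ)
open import Relation.Binary.PropositionalEquality
open import Relation.Nullary using (¬_; Dec; yes; no; does)
open import Relation.Nullary.Decidable using (T?; ¬?)
open import Relation.Unary using (Pred; ∅; _∪_; _⊆_)

lookup-injective : ∀ {A : Set} {xs : List A} → Unique xs → Injective _≡_ _≡_ (lookup xs)
lookup-injective {xs = x ∷ xs} (_ ∷ u) {Fin.zero}  {Fin.zero}  e = refl
lookup-injective {xs = x ∷ xs} (x∉ ∷ u) {Fin.zero}  {Fin.suc j} e = ⊥-elim (All.lookup x∉ (∈-lookup j) e)
lookup-injective {xs = x ∷ xs} (x∉ ∷ u) {Fin.suc i} {Fin.zero}  e = ⊥-elim (All.lookup x∉ (∈-lookup i) (sym e))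
lookup-injective {xs = x ∷ xs} (_ ∷ u) {Fin.suc i} {Fin.suc j} e = cong Fin.suc (lookup-injective u e)

length-filter-tabulate : ∀ {A : Set} {m} (q : A → Bool) (g : Fin m → A) →
  length (filter (T? ∘ q) (tabulate g)) ≡ count (q ∘ g)
length-filter-tabulate {m = zero} q g = refl
length-filter-tabulate {m = suc m} q g with q (g Fin.zero)
... | true  = cong suc (length-filter-tabulate q (g ∘ Fin.suc))
... | false = length-filter-tabulate q (g ∘ Fin.suc)

lookup-++ˡ : ∀ {A : Set} (xs ys : List A) (i : Fin (length xs)) .(p : length xs ≤ length (xs ++ ys)) →
  lookup (xs ++ ys) (inject≤ i p) ≡ lookup xs i
lookup-++ˡ (x ∷ xs) ys Fin.zero    p = refl
lookup-++ˡ (x ∷ xs) ys (Fin.suc i) p = lookup-++ˡ xs ys i (s≤s⁻¹ p)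

-- U followed by the remaining vertices lists every vertex exactly once, so for |U| ≤ s ≤ n its
-- first s entries form an injection Fin s → Fin n through which lookup U factors.
module _ {n : ℕ} {U : List (Fin n)} (uU : Unique U) where
  open import Data.List.Membership.DecPropositional (Fin._≟_ {n}) using (_∈?_)

  private
    Rest : List (Fin n)
    Rest = filter (λ v → ¬? (v ∈? U)) (allFin n)

    unique-U++Rest : Unique (U ++ Rest)
    unique-U++Rest = Uniqueₚ.++⁺ uU (Uniqueₚ.filter⁺ (λ v → ¬? (v ∈? U)) (Uniqueₚ.allFin⁺ n))
      λ (v∈U , v∈Rest) → proj₂ (∈-filter⁻ (λ v → ¬? (v ∈? U)) {xs = allFin n} v∈Rest) v∈U

    ∈-U++Rest : ∀ v → v ∈ U ++ Rest
    ∈-U++Rest v with v ∈? U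
    ... | yes v∈U = ∈-++⁺ˡ v∈U
    ... | no  v∉U = ∈-++⁺ʳ U (∈-filter⁺ (λ v → ¬? (v ∈? U)) (∈-allFin v) v∉U)

    n≤length : n ≤ length (U ++ Rest)
    n≤length with n ≤? length (U ++ Rest)
    ... | yes n≤ = n≤
    ... | no  n≰ with Finₚ.pigeonhole (≰⇒> n≰) (index ∘ ∈-U++Rest)
    ...   | i , j , i<j , same = ⊥-elim (Finₚ.<⇒≢ i<j
            (trans (lookup-index (∈-U++Rest i)) (trans (cong (lookup (U ++ Rest)) same)
                   (sym (lookup-index (∈-U++Rest j))))))

  embedding-through : ∀ {s} → length U ≤ s → s ≤ n →
    Σ (Fin s → Fin n) λ ι → Injective _≡_ _≡_ ι ×
    Σ (Fin (length U) → Fin s) λ e → Injective _≡_ _≡_ e × (∀ i → ι (e i) ≡ lookup U i)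
  embedding-through {s} U≤s s≤n = ι , ι-injective , e , e-injective , ι∘e
    where
    s≤ : s ≤ length (U ++ Rest)
    s≤ = ≤-trans s≤n n≤length
    ι : Fin s → Fin n
    ι i = lookup (U ++ Rest) (inject≤ i s≤)
    ι-injective : Injective _≡_ _≡_ ι
    ι-injective eq = Finₚ.inject≤-injective s≤ s≤ _ _ (lookup-injective unique-U++Rest eq)
    e : Fin (length U) → Fin s
    e i = inject≤ i U≤s
    e-injective : Injective _≡_ _≡_ e
    e-injective = Finₚ.inject≤-injective U≤s U≤s _ _
    ι∘e : ∀ i → ι (e i) ≡ lookup U i
    ι∘e i = trans (cong (lookup (U ++ Rest)) (Finₚ.toℕ-injective (begin
        toℕ (inject≤ (inject≤ i U≤s) s≤) ≡⟨ Finₚ.toℕ-inject≤ _ s≤ ⟩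
        toℕ (inject≤ i U≤s)              ≡⟨ Finₚ.toℕ-inject≤ i U≤s ⟩
        toℕ i                            ≡⟨ Finₚ.toℕ-inject≤ i (length-++-≤ˡ U) ⟨
        toℕ (inject≤ i (length-++-≤ˡ U)) ∎)))
      (lookup-++ˡ U Rest i (length-++-≤ˡ U))
      where open ≡-Reasoning

-- f need not be monotone, so the separator of G[U] is taken in an induced subgraph with exactly
-- s vertices containing U.
subproblem-separator : ∀ {C : Class} {f : ℕ → ℕ} → Hereditary C → Separable C f →
  ∀ {n} {G : Graph n} → C G → ∀ {U : List (Fin n)} → Unique U → ∀ {s} → length U ≤ s → s ≤ n →
  HasSeparator (induced G (lookup U)) (f s)
subproblem-separator hered sep {G = G} CG {U} uU U≤s s≤n
  with embedding-through uU U≤s s≤n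
... | ι , ι-injective , e , e-injective , ι∘e
  with sep _ (induced G ι) (hered G ι ι-injective CG)
... | s' , s'≤ , separators
  with separators (length U) (induced G (lookup U))
         (e , e-injective , λ i j → subst₂ (Adj G) (sym (ι∘e i)) (sym (ι∘e j)))
... | lab , |S|≤ , rest = lab , ≤-trans |S|≤ s'≤ , rest

module Regions {n : ℕ} (G : Graph n) where

  Region : Set₁
  Region = Pred (Fin n) 0ℓ

  Closed : Region → Region → Set
  Closed X Gd = ∀ {v u} → X v → Step G u v → X u ⊎ Gd u

  closed-weaken : ∀ {X Gd Gd'} → Gd ⊆ Gd' → Closed X Gd → Closed X Gd'
  closed-weaken Gd⊆ clX x st = Sum.map₂ Gd⊆ (clX x st)

  closed-∪ : ∀ {X Y Gd} → Closed X Gd → Closed Y (X ∪ Gd) → Closed (X ∪ Y) Gd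
  closed-∪ clX clY (inj₁ x) st = Sum.map₁ inj₁ (clX x st)
  closed-∪ clX clY (inj₂ y) st with clY y st
  ... | inj₁ y'         = inj₁ (inj₂ y')
  ... | inj₂ (inj₁ x)   = inj₁ (inj₁ x)
  ... | inj₂ (inj₂ gd)  = inj₂ gd

module Parts {n : ℕ} (G : Graph n) {U : List (Fin n)} (uU : Unique U) (lab : Fin (length U) → Part) where
  open Regions G

  part : (Part → Bool) → List (Fin n)
  part q = map (lookup U) (filter (T? ∘ q ∘ lab) (allFin (length U)))

  length-part : ∀ q → length (part q) ≡ count (q ∘ lab)
  length-part q = trans (length-map (lookup U) (filter (T? ∘ q ∘ lab) (allFin (length U))))
    (length-filter-tabulate (q ∘ lab) (λ i → i))

  unique-part : ∀ q → Unique (part q)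
  unique-part q = Uniqueₚ.map⁺ (lookup-injective uU) (Uniqueₚ.filter⁺ (T? ∘ q ∘ lab) (Uniqueₚ.allFin⁺ _))

  ∈-part⁻ : ∀ q {v} → v ∈ part q → ∃ λ i → T (q (lab i)) × v ≡ lookup U i
  ∈-part⁻ q v∈ with ∈-map⁻ (lookup U) v∈
  ... | i , i∈ , refl = i , proj₂ (∈-filter⁻ (T? ∘ q ∘ lab) {xs = allFin _} i∈) , refl

  ∈-part⁺ : ∀ q {u} (u∈U : u ∈ U) → T (q (lab (index u∈U))) → u ∈ part q
  ∈-part⁺ q u∈U t = subst (_∈ part q) (sym (lookup-index u∈U))
    (∈-map⁺ (lookup U) (∈-filter⁺ (T? ∘ q ∘ lab) (∈-allFin _) t))

  part⊆ : ∀ q → (_∈ part q) ⊆ (_∈ U)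
  part⊆ q v∈ with ∈-part⁻ q v∈
  ... | i , _ , refl = ∈-lookup i

  A B S : List (Fin n)
  A = part isA
  B = part isB
  S = part isS

  classify : (_∈ U) ⊆ (_∈ A) ∪ ((_∈ B) ∪ (_∈ S))
  classify u∈U with lab (index u∈U) in eq
  ... | inA = inj₁ (∈-part⁺ isA u∈U (subst (T ∘ isA) (sym eq) tt))
  ... | inB = inj₂ (inj₁ (∈-part⁺ isB u∈U (subst (T ∘ isB) (sym eq) tt)))
  ... | inS = inj₂ (inj₂ (∈-part⁺ isS u∈U (subst (T ∘ isS) (sym eq) tt)))

  closed-A : ∀ {Gd} → Closed (_∈ U) Gd → Closed (_∈ A) (Gd ∪ ((_∈ B) ∪ (_∈ S)))
  closed-A clU a st with clU (part⊆ isA a) st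
  ... | inj₂ gd  = inj₂ (inj₁ gd)
  ... | inj₁ u∈U with classify u∈U
  ...   | inj₁ u∈A  = inj₁ u∈A
  ...   | inj₂ u∈BS = inj₂ (inj₂ u∈BS)

  module _ (no-edge : ∀ i j → lab i ≡ inA → lab j ≡ inB → ¬ Adj G (lookup U i) (lookup U j)) where

    no-A-B-edge : ∀ {u v} → u ∈ A → v ∈ B → ¬ Adj G u v
    no-A-B-edge u∈A v∈B with ∈-part⁻ isA u∈A | ∈-part⁻ isB v∈B
    ... | i , ti , refl | j , tj , refl = no-edge i j (isA⁻¹ _ ti) (isB⁻¹ _ tj)
      where
      isA⁻¹ : ∀ p → T (isA p) → p ≡ inA
      isA⁻¹ inA _ = refl
      isB⁻¹ : ∀ p → T (isB p) → p ≡ inB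
      isB⁻¹ inB _ = refl

    closed-B : ∀ {Gd} → Closed (_∈ U) Gd → Closed (_∈ B) (Gd ∪ (_∈ S))
    closed-B clU b (inj₁ refl) = inj₁ b
    closed-B clU b (inj₂ adj) with clU (part⊆ isB b) (inj₂ adj)
    ... | inj₂ gd  = inj₂ (inj₁ gd)
    ... | inj₁ u∈U with classify u∈U
    ...   | inj₁ u∈A        = ⊥-elim (no-A-B-edge u∈A b adj)
    ...   | inj₂ (inj₁ u∈B) = inj₁ u∈B
    ...   | inj₂ (inj₂ u∈S) = inj₂ (inj₂ u∈S)

*≤⇒≤/ : ∀ a b c .{{_ : NonZero c}} → a * c ≤ b → a ≤ b / c
*≤⇒≤/ a b c le = subst (_≤ b / c) (m*n/n≡m a c) (/-monoˡ-≤ c le)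

shrink-zero : ∀ n → shrink 0 n ≡ n
shrink-zero n = trans (cong (_/ 1) (*-identityˡ n)) (n/1≡n n)

shrink≤ : ∀ d n → shrink d n ≤ n
shrink≤ d n = begin
  2 ^ d * n / 3 ^ d ≤⟨ /-monoˡ-≤ (3 ^ d) (*-monoˡ-≤ n (^-monoˡ-≤ d (n≤1+n 2))) ⟩
  3 ^ d * n / 3 ^ d ≡⟨ cong (_/ 3 ^ d) (*-comm (3 ^ d) n) ⟩
  n * 3 ^ d / 3 ^ d ≡⟨ m*n/n≡m n (3 ^ d) ⟩
  n ∎
  where
  open ≤-Reasoning
  instance _ = m^n≢0 3 d

shrink*3^d≤2^d*n : ∀ d n → shrink d n * 3 ^ d ≤ 2 ^ d * n
shrink*3^d≤2^d*n d n = m/n*n≤m (2 ^ d * n) (3 ^ d) {{m^n≢0 3 d}}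

≤shrink-suc : ∀ d n {a m} → 3 * a ≤ 2 * m → m ≤ shrink d n → a ≤ shrink (suc d) n
≤shrink-suc d n {a} {m} 3a≤2m m≤ = *≤⇒≤/ a (2 ^ suc d * n) (3 ^ suc d) (begin
  a * (3 * 3 ^ d)           ≡⟨ solve 2 (λ a x → a :* (con 3 :* x) := (con 3 :* a) :* x) refl a (3 ^ d) ⟩
  3 * a * 3 ^ d             ≤⟨ *-monoˡ-≤ (3 ^ d) (≤-trans 3a≤2m (*-monoʳ-≤ 2 m≤)) ⟩
  2 * shrink d n * 3 ^ d    ≡⟨ *-assoc 2 (shrink d n) (3 ^ d) ⟩
  2 * (shrink d n * 3 ^ d)  ≤⟨ *-monoʳ-≤ 2 (shrink*3^d≤2^d*n d n) ⟩
  2 * (2 ^ d * n)           ≡⟨ *-assoc 2 (2 ^ d) n ⟨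
  2 * 2 ^ d * n             ∎)
  where
  open ≤-Reasoning
  instance _ = m^n≢0 3 (suc d)

3a≤2m⇒a<m : ∀ {a m} → 3 * a ≤ 2 * m → 1 ≤ m → a < m
3a≤2m⇒a<m {a} {m} 3a≤2m 1≤m = ≰⇒> λ m≤a → <⇒≱ (begin-strict
  2 * m     <⟨ m<m+n (2 * m) 1≤m ⟩
  2 * m + m ≡⟨ solve 1 (λ m → con 2 :* m :+ m := con 3 :* m) refl m ⟩
  3 * m     ∎) (≤-trans (*-monoʳ-≤ 3 m≤a) 3a≤2m)
  where open ≤-Reasoning

part-bounds : ∀ d n {a m fuel} → 3 * a ≤ 2 * m → 1 ≤ m → m ≤ suc fuel → m ≤ shrink d n →
  a ≤ fuel × a ≤ shrink (suc d) n
part-bounds d n 3a≤2m 1≤m m≤1+fuel m≤shrink =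
  s≤s⁻¹ (≤-trans (3a≤2m⇒a<m 3a≤2m 1≤m) m≤1+fuel) , ≤shrink-suc d n 3a≤2m m≤shrink

search-sound : ∀ n k fuel → n * 2 ^ (k + fuel) ≤ 3 ^ (k + fuel) →
  n * 2 ^ search n k fuel ≤ 3 ^ search n k fuel
search-sound n k zero h = subst (λ z → n * 2 ^ z ≤ 3 ^ z) (+-identityʳ k) h
search-sound n k (suc fuel) h with n * 2 ^ k ≤ᵇ 3 ^ k in eq
... | true  = ≤ᵇ⇒≤ (n * 2 ^ k) (3 ^ k) (subst T (sym eq) tt)
... | false = search-sound n (suc k) fuel (subst (λ z → n * 2 ^ z ≤ 3 ^ z) (+-suc k fuel) h)

2*2^[2+n]≤3^[2+n] : ∀ n → 2 * 2 ^ (2 + n) ≤ 3 ^ (2 + n)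
2*2^[2+n]≤3^[2+n] zero    = n≤1+n 8
2*2^[2+n]≤3^[2+n] (suc n) = *-mono-≤ (n≤1+n 2) (2*2^[2+n]≤3^[2+n] n)

n*2^n≤3^n : ∀ n → n * 2 ^ n ≤ 3 ^ n
n*2^n≤3^n zero                = z≤n
n*2^n≤3^n (suc zero)          = n≤1+n 2
n*2^n≤3^n (suc (suc zero))    = n≤1+n 8
n*2^n≤3^n (suc (suc (suc n))) = begin
  (3 + n) * (2 * x)         ≡⟨ solve 2 (λ n x → (con 3 :+ n) :* (con 2 :* x)
                                            := con 2 :* ((con 2 :+ n) :* x) :+ con 2 :* x) refl n x ⟩
  2 * ((2 + n) * x) + 2 * x ≤⟨ +-mono-≤ (*-monoʳ-≤ 2 (n*2^n≤3^n (suc (suc n))))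
                                        (2*2^[2+n]≤3^[2+n] n) ⟩
  2 * y + y                 ≡⟨ +-comm (2 * y) y ⟩
  3 * y                     ∎
  where open ≤-Reasoning
        x = 2 ^ (2 + n)
        y = 3 ^ (2 + n)

n*2^clog32≤3^clog32 : ∀ n → n * 2 ^ clog32 n ≤ 3 ^ clog32 n
n*2^clog32≤3^clog32 n = search-sound n 0 n (n*2^n≤3^n n)

-- If (3/2)^k ≥ n and (2/3)^d n ≥ 2, then (3/2)^d ≤ n/2 < (3/2)^k.
depth<clog : ∀ n k d → n * 2 ^ k ≤ 3 ^ k → 2 * 3 ^ d ≤ 2 ^ d * n → d < k
depth<clog n k d k-big d-small with k ≤? d
... | no  k≰d = ≰⇒> k≰d
... | yes k≤d with m≤n⇒∃[o]m+o≡n k≤d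
...   | j , refl = ⊥-elim (<⇒≱ 3^j<2*3^j (≤-trans 2*3^j≤2^j (^-monoˡ-≤ j (n≤1+n 2))))
  where
  open ≤-Reasoning
  instance
    _ = m^n≢0 3 j
    _ = m^n≢0 3 k
  3^j<2*3^j : 3 ^ j < 2 * 3 ^ j
  3^j<2*3^j = subst (_< 2 * 3 ^ j) (*-identityˡ (3 ^ j)) (*-monoˡ-< (3 ^ j) (n<1+n 1))
  2*3^j≤2^j : 2 * 3 ^ j ≤ 2 ^ j
  2*3^j≤2^j = *-cancelʳ-≤ (2 * 3 ^ j) (2 ^ j) (3 ^ k) (begin
    2 * 3 ^ j * 3 ^ k     ≡⟨ solve 2 (λ a b → con 2 :* b :* a := con 2 :* (a :* b)) refl (3 ^ k) (3 ^ j) ⟩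
    2 * (3 ^ k * 3 ^ j)   ≡⟨ cong (2 *_) (^-distribˡ-+-* 3 k j) ⟨
    2 * 3 ^ (k + j)       ≤⟨ d-small ⟩
    2 ^ (k + j) * n       ≡⟨ cong (_* n) (^-distribˡ-+-* 2 k j) ⟩
    2 ^ k * 2 ^ j * n     ≡⟨ solve 3 (λ a b c → a :* b :* c := b :* (c :* a)) refl (2 ^ k) (2 ^ j) n ⟩
    2 ^ j * (n * 2 ^ k)   ≤⟨ *-monoʳ-≤ (2 ^ j) k-big ⟩
    2 ^ j * 3 ^ k         ∎)

depth≤ℓ : ∀ d n → 2 ≤ shrink d n → d ≤ ℓ n
depth≤ℓ d n 2≤ = ≤-trans (<⇒≤ (depth<clog n (clog32 n) d (n*2^clog32≤3^clog32 n)
  (≤-trans (*-monoˡ-≤ (3 ^ d) 2≤) (shrink*3^d≤2^d*n d n)))) (m≤m+n (clog32 n) 1)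

-- Slot (0 , k) is the k-th leaf cop; slot (d + 1 , k) is the k-th cop on the depth-d separator.
Slot : Set
Slot = ℕ × ℕ

_≟ˢ_ : (a b : Slot) → Dec (a ≡ b)
_≟ˢ_ = ≡-dec _≟_ _≟_

AncestorSlot : ℕ → Slot → Set
AncestorSlot d (level , _) = 1 ≤ level × level ≤ d

module Layout (f : ℕ → ℕ) (n : ℕ) where

  separatorSlot : (L : ℕ) → Fin (sumTo f n L) → Slot
  separatorSlot zero    i = 1 , toℕ i
  separatorSlot (suc L) i = [ separatorSlot L , (λ k → 2 + L , toℕ k) ]′ (splitAt (sumTo f n L) i)

  separatorSlot-onto : ∀ L {d k} → d ≤ L → k < f (shrink d n) → ∃ λ i → separatorSlot L i ≡ (suc d , k)
  separatorSlot-onto zero {zero} _ k< = fromℕ< k< , cong (1 ,_) (Finₚ.toℕ-fromℕ< k<)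
  separatorSlot-onto (suc L) d≤ k< with m≤n⇒m<n∨m≡n d≤
  ... | inj₂ refl = sumTo f n L ↑ʳ fromℕ< k< ,
    trans (cong [ separatorSlot L , _ ]′ (Finₚ.splitAt-↑ʳ (sumTo f n L) _ (fromℕ< k<)))
          (cong (2 + L ,_) (Finₚ.toℕ-fromℕ< k<))
  ... | inj₁ d<1+L with separatorSlot-onto L (s≤s⁻¹ d<1+L) k<
  ...   | i , eq = i ↑ˡ _ , trans (cong [ separatorSlot L , _ ]′ (Finₚ.splitAt-↑ˡ (sumTo f n L) i _)) eq

  slot : Fin (Cf f n) → Slot
  slot j = [ (λ k → 0 , toℕ k) , separatorSlot (ℓ n) ]′ (splitAt (f n) j)

  leaf-slot : ∀ {k} → k < f n → ∃ λ j → slot j ≡ (0 , k)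
  leaf-slot k< = fromℕ< k< ↑ˡ _ ,
    trans (cong [ _ , separatorSlot (ℓ n) ]′ (Finₚ.splitAt-↑ˡ (f n) (fromℕ< k<) _))
          (cong (0 ,_) (Finₚ.toℕ-fromℕ< k<))

  separator-slot : ∀ {d k} → d ≤ ℓ n → k < f (shrink d n) → ∃ λ j → slot j ≡ (suc d , k)
  separator-slot d≤ k< with separatorSlot-onto (ℓ n) d≤ k<
  ... | i , eq = f n ↑ʳ i , trans (cong [ _ , separatorSlot (ℓ n) ]′ (Finₚ.splitAt-↑ʳ (f n) _ i)) eq

module Schedules {n : ℕ} (G : Graph n) {k : ℕ} (slot : Fin k → Slot) where
  open Regions G public

  Placement : Set
  Placement = Slot → Fin n

  data OccupiedBy (σ : Placement) (P : Slot → Set) (u : Fin n) : Set where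
    cop : (j : Fin k) → P (slot j) → σ (slot j) ≡ u → OccupiedBy σ P u

  Occupied : Placement → Region
  Occupied σ = OccupiedBy σ (λ _ → ⊤)

  forget : ∀ {σ P} → OccupiedBy σ P ⊆ Occupied σ
  forget (cop j _ σj≡u) = cop j tt σj≡u

  Moves : Placement → Placement → Set
  Moves σ τ = ∀ j → Step G (σ (slot j)) (τ (slot j))

  Guarded : Region → Placement → Placement → Region → Set
  Guarded X σ τ Y = ∀ {v u} → Y v → Step G u v → X u ⊎ Occupied σ u ⊎ Occupied τ u

  -- A schedule in Clearing σ X τ W leads the cops from σ to τ so that a robber ending in W has
  -- started in X or been caught (escaped-or-caught). A robber now at v stood at u, its previous
  -- vertex, both before and after the cops' move of that round, which is what Guarded exploits.
  data Clearing : Placement → Region → Placement → Region → Set₁ where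
    stop  : ∀ {σ τ X W} → σ ≗ τ → W ⊆ X → Clearing σ X τ W
    round : ∀ {σ τ ρ X Y W} → Moves σ τ → Guarded X σ τ Y → Clearing τ Y ρ W → Clearing σ X ρ W

  schedule : ∀ {σ X τ W} → Clearing σ X τ W → ℕ → Placement
  schedule (stop {σ = σ} _ _)    t       = σ
  schedule (round {σ = σ} _ _ _) zero    = σ
  schedule (round _ _ c)         (suc t) = schedule c t

  duration : ∀ {σ X τ W} → Clearing σ X τ W → ℕ
  duration (stop _ _)    = 0
  duration (round _ _ c) = suc (duration c)

  schedule-zero : ∀ {σ X τ W} (c : Clearing σ X τ W) → schedule c 0 ≡ σ
  schedule-zero (stop _ _)    = refl
  schedule-zero (round _ _ _) = refl

  schedule-moves : ∀ {σ X τ W} (c : Clearing σ X τ W) t → Moves (schedule c t) (schedule c (suc t))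
  schedule-moves (stop _ _)       t       j = inj₁ refl
  schedule-moves (round mv _ c)   zero    j = subst (Step G _) (cong (λ σ → σ (slot j)) (sym (schedule-zero c))) (mv j)
  schedule-moves (round _ _ c)    (suc t) j = schedule-moves c t j

  copWalk : ∀ {σ X τ W} → Clearing σ X τ W → CopWalk G k
  copWalk c = (λ t j → schedule c t (slot j)) , schedule-moves c

  escaped-or-caught : ∀ {σ X τ W} (c : Clearing σ X τ W) ((r , r-steps) : RobberWalk G) →
    W (r (duration c)) → X (r 0) ⊎ Caught G (copWalk c) (r , r-steps)
  escaped-or-caught (stop _ W⊆X) _ w = inj₁ (W⊆X w)
  escaped-or-caught (round _ guarded c) (r , r-steps) w
    with escaped-or-caught c (r ∘ suc , r-steps ∘ suc) w
  ... | inj₂ (t , j , caught) = inj₂ (suc t , j , caught)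
  ... | inj₁ y with guarded y (r-steps 0)
  ...   | inj₁ x                      = inj₁ x
  ...   | inj₂ (inj₁ (cop j _ at-r0)) = inj₂ (0 , j , inj₁ at-r0)
  ...   | inj₂ (inj₂ (cop j _ at-r0)) =
    inj₂ (0 , j , inj₂ (trans (cong (λ σ → σ (slot j)) (schedule-zero c)) at-r0))

  copsWin : ∀ {σ τ} → Clearing σ ∅ τ (λ _ → ⊤) → CopsWin G k
  copsWin c = copWalk c , λ rw → [ (λ ()) , (λ caught → caught) ]′ (escaped-or-caught c rw tt)

  start-from : ∀ {σ σ' τ X X' W} → σ ≗ σ' → X' ⊆ X → Clearing σ' X' τ W → Clearing σ X τ W
  start-from σ≗σ' X'⊆X (stop σ'≗τ W⊆X') = stop (λ a → trans (σ≗σ' a) (σ'≗τ a)) (X'⊆X ∘ W⊆X')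
  start-from {σ} {X = X} σ≗σ' X'⊆X (round {τ = τ} mv guarded c) = round mv' guarded' c
    where
    mv' : Moves σ τ
    mv' j = subst (λ x → Step G x (τ (slot j))) (sym (σ≗σ' (slot j))) (mv j)
    guarded' : Guarded X σ τ _
    guarded' y st with guarded y st
    ... | inj₁ x'                   = inj₁ (X'⊆X x')
    ... | inj₂ (inj₁ (cop j _ eq)) = inj₂ (inj₁ (cop j tt (trans (σ≗σ' _) eq)))
    ... | inj₂ (inj₂ occ)          = inj₂ (inj₂ occ)

  infixr 5 _⨾_
  _⨾_ : ∀ {σ τ ρ X W V} → Clearing σ X τ W → Clearing τ W ρ V → Clearing σ X ρ V
  stop σ≗τ W⊆X    ⨾ c' = start-from σ≗τ W⊆X c'
  round mv gd c   ⨾ c' = round mv gd (c ⨾ c')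

  end-at : ∀ {σ τ τ' X W} → Clearing σ X τ W → τ ≗ τ' → Clearing σ X τ' W
  end-at c τ≗τ' = c ⨾ stop τ≗τ' (λ w → w)

  settle : ∀ {σ X Y Gd} → Closed Y Gd → Y ⊆ X ∪ Occupied σ → Gd ⊆ Occupied σ → Clearing σ X σ Y
  settle {σ} {X} {Y} clY Y⊆ Gd⊆ = round (λ _ → inj₁ refl) guarded (stop (λ _ → refl) (λ y → y))
    where
    guarded : Guarded X σ σ Y
    guarded y st with clY y st
    ... | inj₁ y' = Sum.map₂ inj₁ (Y⊆ y')
    ... | inj₂ gd = inj₂ (inj₁ (Gd⊆ gd))

  _[_↦_] : Placement → Slot → Fin n → Placement
  (σ [ a ↦ v ]) b = if does (b ≟ˢ a) then v else σ b

  ↦-same : ∀ σ a v → (σ [ a ↦ v ]) a ≡ v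
  ↦-same σ a v with a ≟ˢ a
  ... | yes _  = refl
  ... | no a≢a = ⊥-elim (a≢a refl)

  ↦-other : ∀ σ {a} v {b} → b ≢ a → (σ [ a ↦ v ]) b ≡ σ b
  ↦-other σ {a} v {b} b≢a with b ≟ˢ a
  ... | yes b≡a = ⊥-elim (b≢a b≡a)
  ... | no _    = refl

  ↦-↦ : ∀ σ a v w b → ((σ [ a ↦ w ]) [ a ↦ v ]) b ≡ (σ [ a ↦ v ]) b
  ↦-↦ σ a v w b with b ≟ˢ a
  ... | yes _ = refl
  ... | no _  = refl

  occupiedBy-↦ : ∀ {P a σ v} → ¬ P a → OccupiedBy σ P ⊆ OccupiedBy (σ [ a ↦ v ]) P
  occupiedBy-↦ {P} {a} {σ} {v} ¬Pa (cop j Pj eq) =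
    cop j Pj (trans (↦-other σ v λ j≡a → ¬Pa (subst P j≡a Pj)) eq)

  walk : ∀ {X P a} → ¬ P a → ∀ {x v} → Reach G x v → ∀ σ → σ a ≡ x →
    Closed X (OccupiedBy σ P) → Clearing σ X (σ [ a ↦ v ]) X
  walk {a = a} ¬Pa here σ σa≡x clX = stop σ≗ (λ x → x)
    where
    σ≗ : σ ≗ σ [ a ↦ _ ]
    σ≗ b with b ≟ˢ a
    ... | yes refl = σa≡x
    ... | no _     = refl
  walk {X} {P} {a} ¬Pa {v = v} (there {v = w} adj path) σ σa≡x clX =
    round moves guarded (end-at (walk ¬Pa path (σ [ a ↦ w ]) (↦-same σ a w)
                                      (closed-weaken (occupiedBy-↦ ¬Pa) clX))
                                (↦-↦ σ a v w))
    where
    moves : Moves σ (σ [ a ↦ w ])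
    moves j with slot j ≟ˢ a
    ... | yes refl = inj₂ (subst (λ z → Adj G z w) (sym σa≡x) adj)
    ... | no _     = inj₁ refl
    guarded : Guarded X σ (σ [ a ↦ w ]) X
    guarded x st = Sum.map₂ (inj₁ ∘ forget) (clX x st)

  place : Placement → ℕ → ℕ → List (Fin n) → Placement
  place σ b i []       = σ
  place σ b i (x ∷ xs) = place (σ [ (b , i) ↦ x ]) b (suc i) xs

  place-clearing : ∀ {X P} b → (∀ i → ¬ P (b , i)) → Connected G →
    ∀ xs σ i → Closed X (OccupiedBy σ P) → Clearing σ X (place σ b i xs) X
  place-clearing b ¬P conn []       σ i clX = stop (λ _ → refl) (λ x → x)
  place-clearing b ¬P conn (x ∷ xs) σ i clX =
    walk (¬P i) (conn (σ (b , i)) x) σ refl clX ⨾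
    place-clearing b ¬P conn xs (σ [ (b , i) ↦ x ]) (suc i) (closed-weaken (occupiedBy-↦ (¬P i)) clX)

  place-other : ∀ b xs σ i {a} → (∀ i' → i ≤ i' → a ≢ (b , i')) → place σ b i xs a ≡ σ a
  place-other b []       σ i a∉ = refl
  place-other b (x ∷ xs) σ i a∉ =
    trans (place-other b xs (σ [ (b , i) ↦ x ]) (suc i) (λ i' i<i' → a∉ i' (<⇒≤ i<i')))
          (↦-other σ x (a∉ i ≤-refl))

  place-outside : ∀ {P : Slot → Set} b → (∀ i → ¬ P (b , i)) → ∀ xs σ {a} → P a → place σ b 0 xs a ≡ σ a
  place-outside {P} b ¬P xs σ Pa = place-other b xs σ 0 λ i' _ a≡ → ¬P i' (subst P a≡ Pa)

  place-hit : ∀ b xs σ i {x} → x ∈ xs → ∃ λ i' → i' < i + length xs × place σ b i xs (b , i') ≡ x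
  place-hit b (x ∷ xs) σ i (here refl) = i , m<m+n i (s≤s z≤n) ,
    trans (place-other b xs (σ [ (b , i) ↦ x ]) (suc i) (λ i' i<i' eq → <⇒≢ i<i' (cong proj₂ eq)))
          (↦-same σ (b , i) x)
  place-hit b (y ∷ xs) σ i (there x∈) with place-hit b xs (σ [ (b , i) ↦ y ]) (suc i) x∈
  ... | i' , i'< , eq = i' , subst (i' <_) (sym (+-suc i (length xs))) i'< , eq

module STT {C : Class} (hered : Hereditary C) {f : ℕ → ℕ} (f≥1 : ∀ m → 1 ≤ m → 1 ≤ f m)
           (sep : Separable C f) {n : ℕ} {G : Graph n} (n≥1 : 1 ≤ n) (conn : Connected G) (CG : C G) where
  open Layout f n
  open Schedules G slot

  Guard : ℕ → Placement → Region
  Guard d σ = OccupiedBy σ (AncestorSlot d)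

  guard-suc : ∀ {d σ} → Guard d σ ⊆ Guard (suc d) σ
  guard-suc (cop j (1≤ , ≤d) eq) = cop j (1≤ , m≤n⇒m≤1+n ≤d) eq

  record Keeps (d : ℕ) (σ σ' : Placement) : Set where
    constructor keeps
    field kept : ∀ {a} → AncestorSlot d a → σ' a ≡ σ a
  open Keeps

  keeps-guard : ∀ {d σ σ'} → Keeps d σ σ' → Guard d σ ⊆ Guard d σ'
  keeps-guard ks (cop j anc eq) = cop j anc (trans (kept ks anc) eq)

  keeps-pred : ∀ {d σ σ'} → Keeps (suc d) σ σ' → Keeps d σ σ'
  keeps-pred ks = keeps λ (1≤ , ≤d) → kept ks (1≤ , m≤n⇒m≤1+n ≤d)

  keeps-trans : ∀ {d σ σ' σ''} → Keeps d σ σ' → Keeps d σ' σ'' → Keeps d σ σ''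
  keeps-trans ks ks' = keeps λ anc → trans (kept ks' anc) (kept ks anc)

  place-keeps : ∀ {d} b → (∀ i → ¬ AncestorSlot d (b , i)) → ∀ xs σ → Keeps d σ (place σ b 0 xs)
  place-keeps b ¬anc xs σ = keeps (place-outside b ¬anc xs σ)

  leaf-occupied : ∀ σ xs → length xs ≤ f n → (_∈ xs) ⊆ Occupied (place σ 0 0 xs)
  leaf-occupied σ xs |xs|≤ x∈ with place-hit 0 xs σ 0 x∈
  ... | i , i< , at-i with leaf-slot (<-≤-trans i< |xs|≤)
  ...   | j , slot-j = cop j tt (trans (cong (place σ 0 0 xs) slot-j) at-i)

  separator-guarded : ∀ {d} σ xs → d ≤ ℓ n → length xs ≤ f (shrink d n) →
    (_∈ xs) ⊆ Guard (suc d) (place σ (suc d) 0 xs)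
  separator-guarded {d} σ xs d≤ℓ |xs|≤ x∈ with place-hit (suc d) xs σ 0 x∈
  ... | i , i< , at-i with separator-slot d≤ℓ (<-≤-trans i< |xs|≤)
  ...   | j , slot-j = cop j (subst (AncestorSlot (suc d)) (sym slot-j) (s≤s z≤n , ≤-refl))
                              (trans (cong (place σ (suc d) 0 xs) slot-j) at-i)

  Clears : ℕ → Placement → Region → Region → Set₁
  Clears d σ X Y = Σ Placement λ σ' → Clearing σ X σ' Y × Keeps d σ σ'

  -- A call of STT at depth d on the vertex set U, with X already cleared: the two Closed hypotheses
  -- are the invariant of the recursion, and Keeps d says the ancestor separators stay in place.
  Clearer : ℕ → Set₁
  Clearer fuel = ∀ d {U} σ X → Unique U → length U ≤ fuel → length U ≤ shrink d n →
    Closed X (Guard d σ) → Closed (_∈ U) (X ∪ Guard d σ) → Clears d σ X (X ∪ (_∈ U))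

  clear-leaf : ∀ d {U} σ X → length U ≤ f n →
    Closed X (Guard d σ) → Closed (_∈ U) (X ∪ Guard d σ) → Clears d σ X (X ∪ (_∈ U))
  clear-leaf d {U} σ X small clX clU =
    σ' , place-clearing 0 ¬anc conn U σ 0 clX ⨾ settle (closed-∪ clX clU) U⊆ (λ g → forget (keeps-guard ks g)) ,
    ks
    where
    σ' : Placement
    σ' = place σ 0 0 U
    ¬anc : ∀ i → ¬ AncestorSlot d (0 , i)
    ¬anc _ (() , _)
    ks : Keeps d σ σ'
    ks = place-keeps 0 ¬anc U σ
    U⊆ : X ∪ (_∈ U) ⊆ X ∪ Occupied σ'
    U⊆ = Sum.map₂ (leaf-occupied σ U small)

  clear-both : ∀ {fuel} → Clearer fuel → ∀ d {B A} σ X → Unique B → Unique A →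
    length B ≤ fuel × length B ≤ shrink d n → length A ≤ fuel × length A ≤ shrink d n →
    Closed X (Guard d σ) → Closed (_∈ B) (X ∪ Guard d σ) → Closed (_∈ A) ((X ∪ (_∈ B)) ∪ Guard d σ) →
    Clears d σ X ((X ∪ (_∈ B)) ∪ (_∈ A))
  clear-both clear d σ X uB uA (B≤fuel , B≤shrink) (A≤fuel , A≤shrink) clX clB clA
    with clear d σ X uB B≤fuel B≤shrink clX clB
  ... | σ' , seg , ks with clear d σ' (X ∪ (_∈ _)) uA A≤fuel A≤shrink
                             (closed-weaken (keeps-guard ks) (closed-∪ clX clB))
                             (closed-weaken (Sum.map₂ (keeps-guard ks)) clA)
  ...   | σ'' , seg' , ks' = σ'' , seg ⨾ seg' , keeps-trans ks ks'

  clear-split : ∀ {fuel} → Clearer fuel → ∀ d {U} σ X → Unique U → length U ≤ suc fuel →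
    length U ≤ shrink d n → f n < length U →
    Closed X (Guard d σ) → Closed (_∈ U) (X ∪ Guard d σ) → Clears d σ X (X ∪ (_∈ U))
  clear-split {fuel} clear d {U} σ X uU U≤fuel U≤shrink big clX clU
    with subproblem-separator hered sep CG uU U≤shrink (shrink≤ d n)
  ... | lab , |S|≤ , |A|≤ , |B|≤ , no-edge =
    σ₂ , seg₁ ⨾ seg₂ ⨾ settle (closed-∪ clX clU) U⊆ (λ g → forget (keeps-guard ks₂ (up₁ g))) ,
    keeps-trans ks₁ (keeps-pred ks₂)
    where
    open Parts G uU lab
    bounds : ∀ q → 3 * count (q ∘ lab) ≤ 2 * length U →
      length (part q) ≤ fuel × length (part q) ≤ shrink (suc d) n
    bounds q 3c≤ = part-bounds d n (subst (λ c → 3 * c ≤ 2 * length U) (sym (length-part q)) 3c≤)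
                                   (≤-trans (s≤s z≤n) big) U≤fuel U≤shrink
    d≤ℓ : d ≤ ℓ n
    d≤ℓ = depth≤ℓ d n (≤-trans (s≤s (f≥1 n n≥1)) (≤-trans big U≤shrink))
    ¬anc : ∀ i → ¬ AncestorSlot d (suc d , i)
    ¬anc _ (_ , 1+d≤d) = 1+n≰n 1+d≤d

    σ₁ : Placement
    σ₁ = place σ (suc d) 0 S
    seg₁ : Clearing σ X σ₁ X
    seg₁ = place-clearing (suc d) ¬anc conn S σ 0 clX
    ks₁ : Keeps d σ σ₁
    ks₁ = place-keeps (suc d) ¬anc S σ
    up₁ : Guard d σ ⊆ Guard (suc d) σ₁
    up₁ g = guard-suc (keeps-guard ks₁ g)
    S⊆ : (_∈ S) ⊆ Guard (suc d) σ₁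
    S⊆ = separator-guarded σ S d≤ℓ (subst (_≤ f (shrink d n)) (sym (length-part isS)) |S|≤)

    clB : Closed (_∈ B) (X ∪ Guard (suc d) σ₁)
    clB = closed-weaken [ Sum.map₂ up₁ , (λ s → inj₂ (S⊆ s)) ]′ (closed-B no-edge clU)
    clA : Closed (_∈ A) ((X ∪ (_∈ B)) ∪ Guard (suc d) σ₁)
    clA = closed-weaken
      (λ { (inj₁ (inj₁ x)) → inj₁ (inj₁ x) ; (inj₁ (inj₂ g)) → inj₂ (up₁ g)
         ; (inj₂ (inj₁ b)) → inj₁ (inj₂ b) ; (inj₂ (inj₂ s)) → inj₂ (S⊆ s) })
      (closed-A clU)
    both : Clears (suc d) σ₁ X ((X ∪ (_∈ B)) ∪ (_∈ A))
    both = clear-both clear (suc d) σ₁ X (unique-part isB) (unique-part isA)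
                      (bounds isB |B|≤) (bounds isA |A|≤) (closed-weaken up₁ clX) clB clA
    σ₂ : Placement
    σ₂ = proj₁ both
    seg₂ : Clearing σ₁ X σ₂ ((X ∪ (_∈ B)) ∪ (_∈ A))
    seg₂ = proj₁ (proj₂ both)
    ks₂ : Keeps (suc d) σ₁ σ₂
    ks₂ = proj₂ (proj₂ both)

    U⊆ : X ∪ (_∈ U) ⊆ ((X ∪ (_∈ B)) ∪ (_∈ A)) ∪ Occupied σ₂
    U⊆ (inj₁ x) = inj₁ (inj₁ (inj₁ x))
    U⊆ (inj₂ u) = [ (λ a → inj₁ (inj₂ a))
                  , [ (λ b → inj₁ (inj₁ (inj₂ b))) , (λ s → inj₂ (forget (keeps-guard ks₂ (S⊆ s)))) ]′
                  ]′ (classify u)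

  clear : ∀ fuel → Clearer fuel
  clear fuel d {U} σ X uU U≤fuel U≤shrink clX clU with length U ≤? f n
  ... | yes small = clear-leaf d σ X small clX clU
  clear zero       d σ X uU U≤0 U≤shrink clX clU | no big = ⊥-elim (big (≤-trans U≤0 z≤n))
  clear (suc fuel) d σ X uU U≤fuel U≤shrink clX clU | no big =
    clear-split (clear fuel) d σ X uU U≤fuel U≤shrink (≰⇒> big) clX clU

  cop₀≤Cf : Cop0≤ G (Cf f n)
  cop₀≤Cf = Cf f n , ≤-refl ,
    copsWin (proj₁ (proj₂ whole) ⨾ stop (λ _ → refl) (λ _ → inj₂ (∈-allFin _)))
    where
    |V|≡n : length (allFin n) ≡ n
    |V|≡n = length-tabulate (λ v → v)
    whole : Clears 0 (λ _ → fromℕ< n≥1) ∅ (∅ ∪ (_∈ allFin n))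
    whole = clear n 0 _ ∅ (Uniqueₚ.allFin⁺ n) (≤-reflexive |V|≡n)
      (≤-reflexive (trans |V|≡n (sym (shrink-zero n)))) (λ ()) (λ _ _ → inj₁ (∈-allFin _))

theorem2 : (C : Class) → Hereditary C →
    (f : ℕ → ℕ) → (∀ n → 1 ≤ n → 1 ≤ f n) → Separable C f →
    ∀ n (G : Graph n) → 1 ≤ n → Connected G → C G → Cop0≤ G (Cf f n)
theorem2 C hered f f≥1 sep n G n≥1 conn CG = STT.cop₀≤Cf hered f≥1 sep n≥1 conn CG
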